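{- Let $n$ be a prime power, let $\mathrm{GF}(n)$ be the finite field of order $n$, and let $x$ be a generator of the multiplicative group of $\mathrm{GF}(n)$. Set $a_0=0$ and $a_i=x^{i-1}$ for $i=1,\dots,n-1$ (so $a_1=1$). For $1\le k\le n-1$ let $L_k$ be the $n\times n$ array, with rows and columns indexed by $0,\dots,n-1$ and entries in $\mathrm{GF}(n)$, whose entry in position $(i,j)$ is $a_i+a_k a_j$. Then $\{L_1,\dots,L_{n-1}\}$ is a set of $n-1$ mutually orthogonal Latin squares of order $n$ which is stepwise transitive.
   Context: A $k\times n$ Latin rectangle ($k\le n$) is a $k\times n$ array filled with $n$ symbols such that each row contains each symbol exactly once and each column contains each symbol at most once; for $k=n$ it is a Latin square. Two $k\times n$ Latin rectangles $A=(a_{ij})$, $B=(b_{ij})$ are orthogonal if each ordered pair $(a_{ij},b_{ij})$ occurs at most once. A $t$-MOLR of size $k\times n$ is a set of $t$ pairwise orthogonal $k\times n$ Latin rectangles. The isotopism group $G_{n,k,t}=S_t\times S_k\times S_n\times(S_n)^t$ acts on $t$-MOLR of size $k\times n$: $S_t$ permutes the rectangles, $S_k$ permutes the rows (simultaneously in all rectangles), $S_n$ permutes the columns (simultaneously in all rectangles), and the $i$-th factor of $(S_n)^t$ permutes the symbols within the $i$-th rectangle. The autotopism group $\mathrm{Aut}(A)$ of a $t$-MOLR $A$ is its stabilizer in $G_{n,k,t}$. A $t$-MOLR $A$ is transitive if $\mathrm{Aut}(A)$ acts transitively on the set of rectangles of $A$. A $k\times n$ $t$-MOLR $A$ is an extension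 of a $(k-1)\times n$ $t$-MOLR $B$ if $A$ results from $B$ by adding one more row to each rectangle (equivalently, $B$ is obtained from $A$ by deleting the same row from every rectangle). A $k\times n$ $t$-MOLR $A$ is stepwise transitive if $A$ is transitive and either $k=1$, or $k\ge 2$ and $A$ is an extension of a stepwise transitive $(k-1)\times n$ $t$-MOLR. -}

module Defs where

open import Level using (0ℓ)
open import Data.Nat using (ℕ; zero; suc; _∸_; _^_)
open import Data.Nat.Primality using (Prime)
open import Data.Fin using (Fin; zero; suc; toℕ; punchIn)
open import Data.Product using (Σ; ∃; ∃-syntax; _×_; _,_)
open import Relation.Binary.PropositionalEquality using (_≡_; _≢_)
open import Relation.Nullary using (¬_)
open import Function.Bundles using (_↔_; Inverse)
open import Algebra.Bundles using (CommutativeRing)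

IsPrimePower : ℕ → Set
IsPrimePower n = ∃[ p ] ∃[ e ] (Prime p × n ≡ p ^ suc e)

record IsField (R : CommutativeRing 0ℓ 0ℓ) : Set where
  open CommutativeRing R
  field
    0≉1     : ¬ (0# ≈ 1#)
    inverse : ∀ a → ¬ (a ≈ 0#) → ∃[ b ] (a * b ≈ 1#)

record HasOrder (R : CommutativeRing 0ℓ 0ℓ) (n : ℕ) : Set where
  open CommutativeRing R
  field
    enc      : Carrier → Fin n
    enc-cong : ∀ {a b} → a ≈ b → enc a ≡ enc b
    enc-inj  : ∀ {a b} → enc a ≡ enc b → a ≈ b
    enc-surj : ∀ (s : Fin n) → ∃[ a ] (enc a ≡ s)

module _ (R : CommutativeRing 0ℓ 0ℓ) where
  open CommutativeRing R

  pow : Carrier → ℕ → Carrier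
  pow x zero    = 1#
  pow x (suc m) = x * pow x m

  IsGenerator : Carrier → Set
  IsGenerator x = ¬ (x ≈ 0#) × (∀ a → ¬ (a ≈ 0#) → ∃[ m ] (a ≈ pow x m))

-- t-MOLR of size k × n, symbols taken to be Fin n.
-- A r i j = entry of rectangle r in row i, column j.

MOLRData : ℕ → ℕ → ℕ → Set
MOLRData t k n = Fin t → Fin k → Fin n → Fin n

IsLatinRect : ∀ {k n} → (Fin k → Fin n → Fin n) → Set
IsLatinRect {k} {n} L =
  (∀ i (s : Fin n) → ∃[ j ] (L i j ≡ s × (∀ j' → L i j' ≡ s → j' ≡ j))) ×
  (∀ j i i' → L i j ≡ L i' j → i ≡ i')

Orthogonal : ∀ {k n} → (Fin k → Fin n → Fin n) → (Fin k → Fin n → Fin n) → Set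
Orthogonal A B =
  ∀ i j i' j' → A i j ≡ A i' j' → B i j ≡ B i' j' → (i ≡ i' × j ≡ j')

IsMOLR : ∀ {t k n} → MOLRData t k n → Set
IsMOLR {t} A =
  (∀ r → IsLatinRect (A r)) × (∀ r r' → r ≢ r' → Orthogonal (A r) (A r'))

Perm : ℕ → Set
Perm m = Fin m ↔ Fin m

record Isotopism (t k n : ℕ) : Set where
  field
    σ : Perm t
    ρ : Perm k
    γ : Perm n
    τ : Fin t → Perm n

IsAutotopism : ∀ {t k n} → Isotopism t k n → MOLRData t k n → Set
IsAutotopism g A =
  ∀ r i j → A (to σ r) (to ρ i) (to γ j) ≡ Inverse.to (τ r) (A r i j)
  where open Isotopism g
        open Inverse using (to)

IsTransitive : ∀ {t k n} → MOLRData t k n → Set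
IsTransitive {t} {k} {n} A =
  ∀ (r r' : Fin t) → ∃[ g ] (IsAutotopism {t} {k} {n} g A × Inverse.to (Isotopism.σ g) r ≡ r')

IsExtension : ∀ {t k n} → MOLRData t (suc k) n → MOLRData t k n → Set
IsExtension {t} {k} {n} A B =
  ∃[ p ] (∀ r (i : Fin k) j → B r i j ≡ A r (punchIn p i) j)

data StepwiseTransitive {t n : ℕ} : (k : ℕ) → MOLRData t k n → Set where
  base : ∀ {A : MOLRData t 1 n} →
         IsMOLR A → IsTransitive A → StepwiseTransitive 1 A
  step : ∀ {k} {A : MOLRData t (suc (suc k)) n} (B : MOLRData t (suc k) n) →
         IsMOLR A → IsTransitive A →
         IsExtension A B → StepwiseTransitive (suc k) B →
         StepwiseTransitive (suc (suc k)) A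

-- The construction.  a_0 = 0, a_{i+1} = x^i; the square indexed by
-- r : Fin (n ∸ 1) is L_{r+1}, with a_{r+1} = x^r, so its (i,j) entry is
-- a_i + x^r * a_j (encoded as a symbol in Fin n via enc).

module _ (R : CommutativeRing 0ℓ 0ℓ) {n : ℕ} (ord : HasOrder R n) (x : CommutativeRing.Carrier R) where
  open CommutativeRing R

  aseq : Fin n → Carrier
  aseq zero    = 0#
  aseq (suc i) = pow R x (toℕ i)

  LSquares : MOLRData (n ∸ 1) n n
  LSquares r i j = HasOrder.enc ord (aseq i + pow R x (toℕ r) * aseq j)

-- Since x has multiplicative order n - 1, the sequence a_0, …, a_{n-1} lists every field
-- element once, so L_k (i , j) = a_i + a_k a_j is a Latin square, and for k ≠ l the squares
-- L_k and L_l are orthogonal because (a_k - a_l)(a_j - a_j') = 0 forces j = j'.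
-- Multiplying the square index by a unit c and the column coordinate by c⁻¹ leaves
-- every entry unchanged; choosing c = a_l / a_k gives an autotopism carrying L_k to
-- L_l. This works for any set of distinct rows, so deleting the first row repeatedly
-- keeps the squares transitive, which is stepwise transitivity.
module Submission where

open import Defs
open import Level using (0ℓ)
open import Data.Nat using (ℕ)
open import Data.Product using (_×_)
open import Algebra.Bundles using (CommutativeRing)

open import Data.Nat using (zero; suc; _∸_; _%_; NonZero; >-nonZero)
import Data.Nat as ℕ
open import Data.Nat.Properties
  using (≤-trans; ≤-antisym; <⇒≤; <⇒≱; n<1+n; m∸n≤m; m<n⇒0<n∸m; m+[n∸m]≡n)
open import Data.Nat.DivMod using (_mod_; m%n<n; m≡m%n+[m/n]*n)
open import Data.Fin using (Fin; zero; suc; toℕ; punchIn; punchOut; _≟_; _<_)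
open import Data.Fin.Properties
  using (¬Fin0; toℕ<n; toℕ≤pred[n]; toℕ-fromℕ<; <-cmp; suc-injective; pigeonhole;
         injective⇒≤; punchIn-injective; punchInᵢ≢i; punchOut-injective)
open import Data.Product using (∃-syntax; _,_; proj₁; proj₂)
open import Data.Empty using (⊥-elim)
open import Relation.Nullary using (¬_; yes; no)
open import Relation.Binary.Definitions using (tri<; tri≈; tri>)
open import Relation.Binary.PropositionalEquality using (_≡_; _≢_)
import Relation.Binary.PropositionalEquality as ≡
open import Function.Base using (_∘_)
open import Function.Bundles using (Inverse; mk↔ₛ′)
open import Function.Definitions using (Injective)
open import Function.Construct.Identity using (↔-id)
import Algebra.Properties.Group as GroupProperties
import Algebra.Properties.Ring as RingProperties
import Algebra.Properties.CommutativeSemigroup as CommutativeSemigroupProperties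
import Relation.Binary.Reasoning.Setoid as SetoidReasoning

module CommutativeRingProperties (R : CommutativeRing 0ℓ 0ℓ) where
  open CommutativeRing R
  open CommutativeSemigroupProperties *-commutativeSemigroup using (interchange)
  open SetoidReasoning setoid

  pow-+ : ∀ x i j → pow R x (i ℕ.+ j) ≈ pow R x i * pow R x j
  pow-+ x zero    j = sym (*-identityˡ _)
  pow-+ x (suc i) j = trans (*-congˡ (pow-+ x i j)) (sym (*-assoc _ _ _))

  pow-*-≈1 : ∀ {x d} → pow R x d ≈ 1# → ∀ q → pow R x (q ℕ.* d) ≈ 1#
  pow-*-≈1         xᵈ≈1 zero    = refl
  pow-*-≈1 {x} {d} xᵈ≈1 (suc q) = begin
    pow R x (d ℕ.+ q ℕ.* d)         ≈⟨ pow-+ x d (q ℕ.* d) ⟩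
    pow R x d * pow R x (q ℕ.* d)   ≈⟨ *-cong xᵈ≈1 (pow-*-≈1 xᵈ≈1 q) ⟩
    1# * 1#                         ≈⟨ *-identityˡ 1# ⟩
    1#                              ∎

  pow-mod : ∀ {x} d .{{_ : NonZero d}} → pow R x d ≈ 1# → ∀ k → pow R x (toℕ (k mod d)) ≈ pow R x k
  pow-mod {x} d xᵈ≈1 k = begin
    pow R x (toℕ (k mod d))                     ≡⟨ ≡.cong (pow R x) (toℕ-fromℕ< (m%n<n k d)) ⟩
    pow R x (k % d)                             ≈⟨ *-identityʳ _ ⟨
    pow R x (k % d) * 1#                        ≈⟨ *-congˡ (pow-*-≈1 xᵈ≈1 (k ℕ./ d)) ⟨
    pow R x (k % d) * pow R x (k ℕ./ d ℕ.* d)   ≈⟨ pow-+ x (k % d) _ ⟨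
    pow R x (k % d ℕ.+ k ℕ./ d ℕ.* d)           ≡⟨ ≡.cong (pow R x) (m≡m%n+[m/n]*n k d) ⟨
    pow R x k                                   ∎

  *-unit-interchange : ∀ {c c'} → c * c' ≈ 1# → ∀ a b → (c * a) * (c' * b) ≈ a * b
  *-unit-interchange {c} {c'} cc'≈1 a b = begin
    (c * a) * (c' * b)   ≈⟨ interchange c a c' b ⟩
    (c * c') * (a * b)   ≈⟨ *-congʳ cc'≈1 ⟩
    1# * (a * b)         ≈⟨ *-identityˡ (a * b) ⟩
    a * b                ∎

  *-unit-cancelʳ : ∀ {a w} → a * w ≈ 1# → ∀ b → (b * w) * a ≈ b
  *-unit-cancelʳ {a} {w} aw≈1 b = begin
    (b * w) * a   ≈⟨ *-assoc b w a ⟩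
    b * (w * a)   ≈⟨ *-congˡ (trans (*-comm w a) aw≈1) ⟩
    b * 1#        ≈⟨ *-identityʳ b ⟩
    b             ∎

  -- f realises multiplication by c in the injective coordinate system h.
  module _ {k} (h : Fin k → Carrier) (h-injective : ∀ {i j} → h i ≈ h j → i ≡ j) where

    scaling-cancel : ∀ {c c'} {f f' : Fin k → Fin k} →
                     (∀ i → h (f i) ≈ c * h i) → (∀ i → h (f' i) ≈ c' * h i) →
                     c * c' ≈ 1# → ∀ i → f (f' i) ≡ i
    scaling-cancel {c} {c'} {f} {f'} hf hf' cc'≈1 i = h-injective (begin
      h (f (f' i))     ≈⟨ hf (f' i) ⟩
      c * h (f' i)     ≈⟨ *-congˡ (hf' i) ⟩
      c * (c' * h i)   ≈⟨ *-assoc c c' (h i) ⟨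
      c * c' * h i     ≈⟨ *-congʳ cc'≈1 ⟩
      1# * h i         ≈⟨ *-identityˡ (h i) ⟩
      h i              ∎)

    scalingPerm : ∀ {c c'} → c * c' ≈ 1# → (f f' : Fin k → Fin k) →
                  (∀ i → h (f i) ≈ c * h i) → (∀ i → h (f' i) ≈ c' * h i) → Perm k
    scalingPerm {c} {c'} cc'≈1 f f' hf hf' =
      mk↔ₛ′ f f' (scaling-cancel hf hf' cc'≈1) (scaling-cancel hf' hf (trans (*-comm c' c) cc'≈1))

module FieldProperties (R : CommutativeRing 0ℓ 0ℓ) (isField : IsField R) where
  open CommutativeRing R
  open IsField isField
  open GroupProperties +-group
    using (∙-cancelˡ; ∙-cancelʳ; \\-leftDividesˡ; //-rightDividesˡ; x∙y⁻¹≈ε⇒x≈y; x≈y⇒x∙y⁻¹≈ε)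
  open RingProperties ring using ([y-z]x≈yx-zx)
  open SetoidReasoning setoid

  unit-≉0 : ∀ {c c'} → c * c' ≈ 1# → ¬ c ≈ 0#
  unit-≉0 {c} {c'} cc'≈1 c≈0 = 0≉1 (begin
    0#        ≈⟨ zeroˡ c' ⟨
    0# * c'   ≈⟨ *-congʳ c≈0 ⟨
    c * c'    ≈⟨ cc'≈1 ⟩
    1#        ∎)

  *-cancelˡ-≉0 : ∀ {c a b} → ¬ c ≈ 0# → c * a ≈ c * b → a ≈ b
  *-cancelˡ-≉0 {c} {a} {b} c≉0 ca≈cb with inverse c c≉0
  ... | w , cw≈1 = begin
    a             ≈⟨ CommutativeRingProperties.*-unit-cancelʳ R cw≈1 a ⟨
    (a * w) * c   ≈⟨ *-assoc a w c ⟩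
    a * (w * c)   ≈⟨ *-congˡ (*-comm w c) ⟩
    a * (c * w)   ≈⟨ *-assoc a c w ⟨
    (a * c) * w   ≈⟨ *-congʳ (trans (*-comm a c) (trans ca≈cb (*-comm c b))) ⟩
    (b * c) * w   ≈⟨ *-assoc b c w ⟩
    b * (c * w)   ≈⟨ *-congˡ cw≈1 ⟩
    b * 1#        ≈⟨ *-identityʳ b ⟩
    b             ∎

  *-≉0 : ∀ {a b} → ¬ a ≈ 0# → ¬ b ≈ 0# → ¬ a * b ≈ 0#
  *-≉0 {a} a≉0 b≉0 ab≈0 = b≉0 (*-cancelˡ-≉0 a≉0 (trans ab≈0 (sym (zeroʳ a))))

  *-≈0 : ∀ {c z} → ¬ c ≈ 0# → c * z ≈ 0# → z ≈ 0#
  *-≈0 {c} c≉0 cz≈0 = *-cancelˡ-≉0 c≉0 (trans cz≈0 (sym (zeroʳ c)))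

  affine-surjective : ∀ {c} → ¬ c ≈ 0# → ∀ a b → ∃[ u ] (a + c * u ≈ b)
  affine-surjective {c} c≉0 a b with inverse c c≉0
  ... | w , cw≈1 = w * (- a + b) , (begin
    a + c * (w * (- a + b))   ≈⟨ +-congˡ (*-assoc c w _) ⟨
    a + (c * w) * (- a + b)   ≈⟨ +-congˡ (*-congʳ cw≈1) ⟩
    a + 1# * (- a + b)        ≈⟨ +-congˡ (*-identityˡ _) ⟩
    a + (- a + b)             ≈⟨ \\-leftDividesˡ a b ⟩
    b                         ∎)

  affine-injective : ∀ {c} → ¬ c ≈ 0# → ∀ a {u u'} → a + c * u ≈ a + c * u' → u ≈ u'
  affine-injective c≉0 a eq = *-cancelˡ-≉0 c≉0 (∙-cancelˡ a _ _ eq)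

  +-*-difference : ∀ {a a' c u u'} → a + c * u ≈ a' + c * u' → a ≈ a' + c * (u' - u)
  +-*-difference {a} {a'} {c} {u} {u'} eq = ∙-cancelʳ (c * u) _ _ (begin
    a + c * u                     ≈⟨ eq ⟩
    a' + c * u'                   ≈⟨ +-congˡ (*-congˡ (//-rightDividesˡ u u')) ⟨
    a' + c * ((u' - u) + u)       ≈⟨ +-congˡ (distribˡ c (u' - u) u) ⟩
    a' + (c * (u' - u) + c * u)   ≈⟨ +-assoc a' _ _ ⟨
    a' + c * (u' - u) + c * u     ∎)

  affine-orthogonal : ∀ {c d a a' u u'} → ¬ c ≈ d →
                      a + c * u ≈ a' + c * u' → a + d * u ≈ a' + d * u' → a ≈ a' × u ≈ u'
  affine-orthogonal {c} {d} {a} {a'} {u} {u'} c≉d eq₁ eq₂ = a≈a' , u≈u'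
    where
      cz≈dz : c * (u' - u) ≈ d * (u' - u)
      cz≈dz = ∙-cancelˡ a' _ _ (trans (sym (+-*-difference eq₁)) (+-*-difference eq₂))
      z≈0 : u' - u ≈ 0#
      z≈0 = *-≈0 (c≉d ∘ x∙y⁻¹≈ε⇒x≈y c d)
                 (trans ([y-z]x≈yx-zx (u' - u) c d) (x≈y⇒x∙y⁻¹≈ε cz≈dz))
      u≈u' : u ≈ u'
      u≈u' = sym (x∙y⁻¹≈ε⇒x≈y u' u z≈0)
      a≈a' : a ≈ a'
      a≈a' = ∙-cancelʳ (c * u) _ _ (trans eq₁ (+-congˡ (*-congˡ (sym u≈u'))))

module NonzeroElements (R : CommutativeRing 0ℓ 0ℓ) {N : ℕ} (ord : HasOrder R (suc N)) where
  open CommutativeRing R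
  open HasOrder ord

  nonzeroCode : ∀ {a} → ¬ a ≈ 0# → Fin N
  nonzeroCode {a} a≉0 = punchOut {i = enc 0#} {j = enc a} (λ e → a≉0 (sym (enc-inj e)))

  nonzeroCode-injective : ∀ {a b} (a≉0 : ¬ a ≈ 0#) (b≉0 : ¬ b ≈ 0#) →
                          nonzeroCode a≉0 ≡ nonzeroCode b≉0 → a ≈ b
  nonzeroCode-injective {a} {b} _ _ eq =
    enc-inj (punchOut-injective {i = enc 0#} {j = enc a} {k = enc b} _ _ eq)

  nonzero : Fin N → Carrier
  nonzero s = proj₁ (enc-surj (punchIn (enc 0#) s))

  enc-nonzero : ∀ s → enc (nonzero s) ≡ punchIn (enc 0#) s
  enc-nonzero s = proj₂ (enc-surj (punchIn (enc 0#) s))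

  nonzero-≉0 : ∀ s → ¬ nonzero s ≈ 0#
  nonzero-≉0 s s≈0 = punchInᵢ≢i (enc 0#) s (≡.trans (≡.sym (enc-nonzero s)) (enc-cong s≈0))

  nonzero-injective : ∀ {s s'} → nonzero s ≈ nonzero s' → s ≡ s'
  nonzero-injective {s} {s'} eq = punchIn-injective (enc 0#) s s'
    (≡.trans (≡.sym (enc-nonzero s)) (≡.trans (enc-cong eq) (enc-nonzero s')))

module Generator (R : CommutativeRing 0ℓ 0ℓ) (isField : IsField R) {N : ℕ} .{{_ : NonZero N}}
                 (ord : HasOrder R (suc N)) {x : CommutativeRing.Carrier R} (gen : IsGenerator R x) where
  open CommutativeRing R hiding (zero)
  open IsField isField
  open HasOrder ord
  open CommutativeRingProperties R
  open FieldProperties R isField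
  open NonzeroElements R ord
  open GroupProperties +-group using (∙-cancelʳ)
  open SetoidReasoning setoid

  infix 8 x^_
  x^_ : ℕ → Carrier
  x^ k = pow R x k

  pow-≉0 : ∀ k → ¬ x^ k ≈ 0#
  pow-≉0 zero    1≈0 = 0≉1 (sym 1≈0)
  pow-≉0 (suc k)     = *-≉0 (proj₁ gen) (pow-≉0 k)

  exponent : ∀ {a} → ¬ a ≈ 0# → ℕ
  exponent a≉0 = proj₁ (proj₂ gen _ a≉0)

  pow-exponent : ∀ {a} (a≉0 : ¬ a ≈ 0#) → x^ exponent a≉0 ≈ a
  pow-exponent a≉0 = sym (proj₂ (proj₂ gen _ a≉0))

  pow-∸-≈1 : ∀ {i j} → i ℕ.≤ j → x^ i ≈ x^ j → x^ (j ∸ i) ≈ 1#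
  pow-∸-≈1 {i} {j} i≤j xⁱ≈xʲ = *-cancelˡ-≉0 (pow-≉0 i) (begin
    x^ i * x^ (j ∸ i)    ≈⟨ pow-+ x i (j ∸ i) ⟨
    x^ (i ℕ.+ (j ∸ i))   ≡⟨ ≡.cong x^_ (m+[n∸m]≡n i≤j) ⟩
    x^ j                 ≈⟨ xⁱ≈xʲ ⟨
    x^ i                 ≈⟨ *-identityʳ (x^ i) ⟨
    x^ i * 1#            ∎)

  -- Reducing exponents modulo a period d maps the N nonzero elements injectively into Fin d.
  period-≥ : ∀ d .{{_ : NonZero d}} → x^ d ≈ 1# → N ℕ.≤ d
  period-≥ d xᵈ≈1 = injective⇒≤ residue-injective
    where
      residue : Fin N → Fin d
      residue s = exponent (nonzero-≉0 s) mod d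

      residue-injective : Injective _≡_ _≡_ residue
      residue-injective {s} {s'} eq = nonzero-injective (begin
        nonzero s                     ≈⟨ pow-exponent (nonzero-≉0 s) ⟨
        x^ exponent (nonzero-≉0 s)    ≈⟨ pow-mod d xᵈ≈1 _ ⟨
        x^ toℕ (residue s)            ≡⟨ ≡.cong (λ r → x^ toℕ r) eq ⟩
        x^ toℕ (residue s')           ≈⟨ pow-mod d xᵈ≈1 _ ⟩
        x^ exponent (nonzero-≉0 s')   ≈⟨ pow-exponent (nonzero-≉0 s') ⟩
        nonzero s'                    ∎)

  -- The N + 1 powers x^0, …, x^N cannot all be distinct nonzero elements.
  period-≤ : ∃[ d ] (0 ℕ.< d × d ℕ.≤ N × x^ d ≈ 1#)
  period-≤ with pigeonhole (n<1+n N) (λ i → nonzeroCode (pow-≉0 (toℕ i)))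
  ... | i , j , i<j , codes≡ =
    toℕ j ∸ toℕ i , m<n⇒0<n∸m i<j , ≤-trans (m∸n≤m (toℕ j) (toℕ i)) (toℕ≤pred[n] j) ,
    pow-∸-≈1 (<⇒≤ i<j) (nonzeroCode-injective (pow-≉0 (toℕ i)) (pow-≉0 (toℕ j)) codes≡)

  pow-N≈1 : x^ N ≈ 1#
  pow-N≈1 with period-≤
  ... | d , 0<d , d≤N , xᵈ≈1 =
    ≡.subst (λ e → x^ e ≈ 1#) (≤-antisym d≤N (period-≥ d {{>-nonZero 0<d}} xᵈ≈1)) xᵈ≈1

  pow-distinct : ∀ {i j : Fin N} → i < j → ¬ x^ toℕ i ≈ x^ toℕ j
  pow-distinct {i} {j} i<j xⁱ≈xʲ = <⇒≱ (toℕ<n j)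
    (≤-trans (period-≥ (toℕ j ∸ toℕ i) {{>-nonZero (m<n⇒0<n∸m i<j)}} (pow-∸-≈1 (<⇒≤ i<j) xⁱ≈xʲ))
             (m∸n≤m (toℕ j) (toℕ i)))

  pow-injective : ∀ {i j : Fin N} → x^ toℕ i ≈ x^ toℕ j → i ≡ j
  pow-injective {i} {j} xⁱ≈xʲ with <-cmp i j
  ... | tri< i<j _ _ = ⊥-elim (pow-distinct i<j xⁱ≈xʲ)
  ... | tri≈ _ i≡j _ = i≡j
  ... | tri> _ _ j<i = ⊥-elim (pow-distinct j<i (sym xⁱ≈xʲ))

  log : ∀ {a} → ¬ a ≈ 0# → Fin N
  log a≉0 = exponent a≉0 mod N

  pow-log : ∀ {a} (a≉0 : ¬ a ≈ 0#) → x^ toℕ (log a≉0) ≈ a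
  pow-log a≉0 = trans (pow-mod N pow-N≈1 _) (pow-exponent a≉0)

  α : Fin (suc N) → Carrier
  α = aseq R ord x

  aseq-injective : ∀ {i j} → α i ≈ α j → i ≡ j
  aseq-injective {zero}  {zero}  _     = ≡.refl
  aseq-injective {zero}  {suc j} 0≈xʲ = ⊥-elim (pow-≉0 (toℕ j) (sym 0≈xʲ))
  aseq-injective {suc i} {zero}  xⁱ≈0 = ⊥-elim (pow-≉0 (toℕ i) xⁱ≈0)
  aseq-injective {suc i} {suc j} xⁱ≈xʲ = ≡.cong suc (pow-injective xⁱ≈xʲ)

  index : Carrier → Fin (suc N)
  index b with enc b ≟ enc 0#
  ... | yes _   = zero
  ... | no b≢0 = suc (log (b≢0 ∘ enc-cong))

  aseq-index : ∀ b → α (index b) ≈ b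
  aseq-index b with enc b ≟ enc 0#
  ... | yes b≡0 = sym (enc-inj b≡0)
  ... | no b≢0  = pow-log (b≢0 ∘ enc-cong)

  scaleColumns : ∀ {c c'} → c * c' ≈ 1# → Perm (suc N)
  scaleColumns {c} {c'} cc'≈1 = scalingPerm α aseq-injective cc'≈1
    (λ j → index (c * α j)) (λ j → index (c' * α j)) (λ _ → aseq-index _) (λ _ → aseq-index _)

  scaleSquares : ∀ {c c'} → c * c' ≈ 1# → Perm N
  scaleSquares {c} {c'} cc'≈1 = scalingPerm (λ q → x^ toℕ q) pow-injective cc'≈1
    (λ q → log (*-≉0 c≉0 (pow-≉0 (toℕ q)))) (λ q → log (*-≉0 c'≉0 (pow-≉0 (toℕ q))))
    (λ _ → pow-log _) (λ _ → pow-log _)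
    where
      c≉0  = unit-≉0 cc'≈1
      c'≉0 = unit-≉0 (trans (*-comm c' c) cc'≈1)

  restrictRows : ∀ {k} → (Fin k → Fin (suc N)) → MOLRData N k (suc N)
  restrictRows e r i j = LSquares R ord x r (e i) j

  module _ {k} {e : Fin k → Fin (suc N)} (e-injective : Injective _≡_ _≡_ e) where

    restrictRows-latin : ∀ r → IsLatinRect (restrictRows e r)
    restrictRows-latin r = rows , columns
      where
        c≉0 = pow-≉0 (toℕ r)

        rows : ∀ i s → ∃[ j ] (restrictRows e r i j ≡ s × (∀ j' → restrictRows e r i j' ≡ s → j' ≡ j))
        rows i s with enc-surj s
        ... | b , enc-b≡s with affine-surjective c≉0 (α (e i)) b
        ... | u , solves-u = index u , solves , unique
          where
            solves : restrictRows e r i (index u) ≡ s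
            solves = ≡.trans (enc-cong (trans (+-congˡ (*-congˡ (aseq-index u))) solves-u)) enc-b≡s

            unique : ∀ j' → restrictRows e r i j' ≡ s → j' ≡ index u
            unique j' solves' =
              aseq-injective (affine-injective c≉0 (α (e i)) (enc-inj (≡.trans solves' (≡.sym solves))))

        columns : ∀ j i i' → restrictRows e r i j ≡ restrictRows e r i' j → i ≡ i'
        columns j i i' eq = e-injective (aseq-injective (∙-cancelʳ _ _ _ (enc-inj eq)))

    restrictRows-orthogonal : ∀ r r' → r ≢ r' → Orthogonal (restrictRows e r) (restrictRows e r')
    restrictRows-orthogonal r r' r≢r' i j i' j' eq eq'
      with affine-orthogonal (r≢r' ∘ pow-injective) (enc-inj eq) (enc-inj eq')
    ... | aᵢ≈aᵢ' , aⱼ≈aⱼ' = e-injective (aseq-injective aᵢ≈aᵢ') , aseq-injective aⱼ≈aⱼ'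

    restrictRows-MOLR : IsMOLR (restrictRows e)
    restrictRows-MOLR = restrictRows-latin , restrictRows-orthogonal

  restrictRows-transitive : ∀ {k} (e : Fin k → Fin (suc N)) → IsTransitive (restrictRows e)
  restrictRows-transitive e r r' with inverse (x^ toℕ r) (pow-≉0 (toℕ r))
  ... | w , xʳw≈1
    with inverse (x^ toℕ r' * w) (*-≉0 (pow-≉0 (toℕ r')) (unit-≉0 (trans (*-comm w _) xʳw≈1)))
  ... | c' , cc'≈1 = g , autotopism , σr≡r'
    where
      c = x^ toℕ r' * w

      g : Isotopism N _ (suc N)
      g = record { σ = scaleSquares cc'≈1 ; ρ = ↔-id _ ; γ = scaleColumns (trans (*-comm c' c) cc'≈1)
                 ; τ = λ _ → ↔-id _ }

      autotopism : IsAutotopism g (restrictRows e)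
      autotopism q i j = enc-cong (+-congˡ (begin
        x^ toℕ (Inverse.to (Isotopism.σ g) q) * α (Inverse.to (Isotopism.γ g) j)
          ≈⟨ *-cong (pow-log _) (aseq-index _) ⟩
        (c * x^ toℕ q) * (c' * α j)
          ≈⟨ *-unit-interchange cc'≈1 _ _ ⟩
        x^ toℕ q * α j
          ∎))

      σr≡r' : Inverse.to (Isotopism.σ g) r ≡ r'
      σr≡r' = pow-injective (trans (pow-log _) (*-unit-cancelʳ xʳw≈1 (x^ toℕ r')))

  restrictRows-stepwiseTransitive : ∀ k {e : Fin (suc k) → Fin (suc N)} → Injective _≡_ _≡_ e →
                                    StepwiseTransitive (suc k) (restrictRows e)
  restrictRows-stepwiseTransitive zero    {e} e-injective =
    base (restrictRows-MOLR e-injective) (restrictRows-transitive e)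
  restrictRows-stepwiseTransitive (suc k) {e} e-injective =
    step (restrictRows (e ∘ suc)) (restrictRows-MOLR e-injective) (restrictRows-transitive e)
         (zero , λ _ _ _ → ≡.refl)
         (restrictRows-stepwiseTransitive k (suc-injective ∘ e-injective))

  LSquares-stepwiseTransitiveMOLR : IsMOLR (LSquares R ord x) × StepwiseTransitive (suc N) (LSquares R ord x)
  LSquares-stepwiseTransitiveMOLR =
    restrictRows-MOLR (λ i≡j → i≡j) , restrictRows-stepwiseTransitive N (λ i≡j → i≡j)

theorem1 : (n : ℕ) → IsPrimePower n →
           (R : CommutativeRing 0ℓ 0ℓ) → IsField R → (ord : HasOrder R n) →
           (x : CommutativeRing.Carrier R) → IsGenerator R x →
           IsMOLR (LSquares R ord x) × StepwiseTransitive n (LSquares R ord x)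
theorem1 zero          _ R _ ord _ _   = ⊥-elim (¬Fin0 (HasOrder.enc ord (CommutativeRing.0# R)))
theorem1 (suc (suc _)) _ R F ord _ gen = Generator.LSquares-stepwiseTransitiveMOLR R F ord gen
theorem1 (suc zero)    _ R F ord _ _   = ⊥-elim (IsField.0≉1 F (HasOrder.enc-inj ord (Fin1-unique _ _)))
  where
    Fin1-unique : (i j : Fin 1) → i ≡ j
    Fin1-unique zero zero = ≡.refl
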